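{- Let $k\ge 2$ be an integer, and let $G_1$ and $G_2$ be graphs on disjoint vertex sets with $n_1\ge 1$ and $n_2\ge 1$ vertices respectively. Then the $f$-polynomial of the $k$-cut complex of the disjoint union $G_1+G_2$ is \[ f(\Delta_k(G_1+G_2),x)=x^{n_2}f(\Delta_k(G_1),x)+x^{n_1}f(\Delta_k(G_2),x)+\sum_{j=k}^{n_1+n_2}\left(\binom{n_1+n_2}{j}-\binom{n_1}{j}-\binom{n_2}{j}\right)x^{n_1+n_2-j}. \]
   Context: All graphs are finite and simple. For a graph $G=(V,E)$ with $|V|=n$ and an integer $k\ge 2$, the $k$-cut complex $\Delta_k(G)$ is the simplicial complex on $V$ whose facets are exactly the subsets $F\subseteq V$ with $|F|=n-k$ such that the induced subgraph $G[V\setminus F]$ is disconnected (equivalently, $\sigma\subseteq V$ is a face iff $V\setminus\sigma$ contains a $k$-subset inducing a disconnected subgraph). If there are no such $F$, $\Delta_k(G)$ is the void complex (no faces at all). The disjoint union $G_1+G_2$ has vertex set $V_1\sqcup V_2$ and edge set $E_1\sqcup E_2$. The $f$-polynomial of a simplicial complex $\Delta$ is $f(\Delta,x)=\sum_{i\ge 0} f_{i-1}x^i$, where $f_{i-1}$ is the number of faces of cardinality $i$ (so $f_{ -1}=1$ for a nonvoid complex); the $f$-polynomial of the void complex is $0$. Binomial coefficients $\binom{a}{j}$ with $j>a$ are $0$. -}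

module Defs where

open import Data.Bool using (Bool; true; false; _∧_; _∨_; not; if_then_else_)
open import Data.Nat using (ℕ; zero; suc; _+_; _∸_; _≡ᵇ_; _≤ᵇ_)
open import Data.Nat.Combinatorics using (_C_)
open import Data.Integer as ℤ using (ℤ)
open import Data.Fin using (Fin; zero; suc; splitAt; _≟_)
open import Data.Sum using (inj₁; inj₂)
open import Data.Vec using (Vec; []; _∷_; lookup)
open import Data.List using (List; []; _∷_; map; length; filterᵇ; upTo; allFin; _++_)
open import Data.Bool.ListAction using (all; any)
open import Relation.Nullary.Decidable using (⌊_⌋)
open import Relation.Binary.PropositionalEquality using (_≡_)

record Graph (n : ℕ) : Set where
  field
    adj    : Fin n → Fin n → Bool
    sym    : ∀ u v → adj u v ≡ adj v u
    irrefl : ∀ v → adj v v ≡ false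
open Graph public

Subset : ℕ → Set
Subset n = Vec Bool n

_∈ᵇ_ : ∀ {n} → Fin n → Subset n → Bool
v ∈ᵇ S = lookup S v

card : ∀ {n} → Subset n → ℕ
card []          = 0
card (true ∷ S)  = suc (card S)
card (false ∷ S) = card S

disjointᵇ : ∀ {n} → Subset n → Subset n → Bool
disjointᵇ []      []      = true
disjointᵇ (a ∷ S) (b ∷ T) = not (a ∧ b) ∧ disjointᵇ S T

allSubsets : (n : ℕ) → List (Subset n)
allSubsets zero    = [] ∷ []
allSubsets (suc n) = map (true ∷_) (allSubsets n) ++ map (false ∷_) (allSubsets n)

-- walkᵇ G S m u v : there is a walk of length ≤ m from u to v in G[S]
-- (u, v assumed in S)
walkᵇ : ∀ {n} → Graph n → Subset n → ℕ → Fin n → Fin n → Bool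
walkᵇ G S zero    u v = ⌊ u ≟ v ⌋
walkᵇ {n} G S (suc m) u v =
  ⌊ u ≟ v ⌋ ∨ any (λ w → (w ∈ᵇ S) ∧ adj G u w ∧ walkᵇ G S m w v) (allFin n)

-- G[S] is connected: any two vertices of S are joined by a walk inside S
-- (a graph on n vertices has all paths of length < n, so bound n suffices)
connectedᵇ : ∀ {n} → Graph n → Subset n → Bool
connectedᵇ {n} G S =
  all (λ u → all (λ v → not (u ∈ᵇ S) ∨ not (v ∈ᵇ S) ∨ walkᵇ G S n u v) (allFin n)) (allFin n)

isCutFaceᵇ : ∀ {n} → ℕ → Graph n → Subset n → Bool
isCutFaceᵇ {n} k G σ =
  any (λ T → (card T ≡ᵇ k) ∧ disjointᵇ T σ ∧ not (connectedᵇ G T)) (allSubsets n)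

Poly : Set
Poly = ℕ → ℤ

infixl 6 _+ₚ_
_+ₚ_ : Poly → Poly → Poly
(p +ₚ q) i = p i ℤ.+ q i

xpow_·_ : ℕ → Poly → Poly
(xpow m · p) i = if m ≤ᵇ i then p (i ∸ m) else ℤ.+ 0

mono : ℤ → ℕ → Poly
mono c d i = if i ≡ᵇ d then c else ℤ.+ 0

zeroₚ : Poly
zeroₚ _ = ℤ.+ 0

sumRange : ℕ → ℕ → (ℕ → Poly) → Poly
sumRange a b f = go (map (a +_) (upTo (suc b ∸ a)))
  where
  go : List ℕ → Poly
  go []       = zeroₚ
  go (j ∷ js) = f j +ₚ go js

-- f-polynomial of Δ_k(G): coefficient of x^i is the number of faces of
-- cardinality i (the empty face is counted iff the complex is nonvoid,
-- so the void complex gets the zero polynomial).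
fPolyCut : ∀ {n} → ℕ → Graph n → Poly
fPolyCut {n} k G i =
  ℤ.+ length (filterᵇ (λ σ → (card σ ≡ᵇ i) ∧ isCutFaceᵇ k G σ) (allSubsets n))

unionAdj : ∀ {n₁ n₂} → Graph n₁ → Graph n₂ → Fin (n₁ + n₂) → Fin (n₁ + n₂) → Bool
unionAdj {n₁} G₁ G₂ u v with splitAt n₁ u | splitAt n₁ v
... | inj₁ a | inj₁ b = adj G₁ a b
... | inj₂ a | inj₂ b = adj G₂ a b
... | inj₁ _ | inj₂ _ = false
... | inj₂ _ | inj₁ _ = false

unionSym : ∀ {n₁ n₂} (G₁ : Graph n₁) (G₂ : Graph n₂) u v →
           unionAdj G₁ G₂ u v ≡ unionAdj G₁ G₂ v u
unionSym {n₁} G₁ G₂ u v with splitAt n₁ u | splitAt n₁ v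
... | inj₁ a | inj₁ b = sym G₁ a b
... | inj₂ a | inj₂ b = sym G₂ a b
... | inj₁ _ | inj₂ _ = Relation.Binary.PropositionalEquality.refl
... | inj₂ _ | inj₁ _ = Relation.Binary.PropositionalEquality.refl

unionIrrefl : ∀ {n₁ n₂} (G₁ : Graph n₁) (G₂ : Graph n₂) v → unionAdj G₁ G₂ v v ≡ false
unionIrrefl {n₁} G₁ G₂ v with splitAt n₁ v
... | inj₁ a = irrefl G₁ a
... | inj₂ a = irrefl G₂ a

_⊕_ : ∀ {n₁ n₂} → Graph n₁ → Graph n₂ → Graph (n₁ + n₂)
G₁ ⊕ G₂ = record { adj = unionAdj G₁ G₂ ; sym = unionSym G₁ G₂ ; irrefl = unionIrrefl G₁ G₂ }

-- A set σ = A ∪ B with A ⊆ V(G₁) and B ⊆ V(G₂) is a face of Δ_k(G₁ + G₂) iff its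
-- complement contains a k-set τ inducing a disconnected subgraph.  No edge joins the
-- two sides, so: if B = V(G₂), then τ ⊆ V(G₁) and σ is a face iff A is a face of
-- Δ_k(G₁); symmetrically if A = V(G₁); and if neither happens, the complement meets
-- both sides, so once it has at least k ≥ 2 elements it contains a k-set with a vertex
-- on each side, which is disconnected.  Hence among the sets of size i = n₁ + n₂ − j the
-- first two cases contribute the coefficients of x^n₂ f(Δ_k(G₁)) and x^n₁ f(Δ_k(G₂)),
-- and the third contributes, when j ≥ k, the C(n₁ + n₂, j) − C(n₁, j) − C(n₂, j) sets
-- whose complement lies on neither side alone.

module Submission where

open import Defs
open import Data.Nat using (ℕ; zero; suc; _+_; _∸_; _≤_; _<_; _≡ᵇ_; _≤ᵇ_; z≤n; s≤s)
open import Data.Nat.Properties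
  using ( ≤-refl; ≤-reflexive; ≤-trans; <-trans; <-irrefl; <-cmp; <⇒≤; <⇒≱; ≤⇒≯; ≰⇒>; _≤?_; _≟_
        ; n≤1+n; n<1+n; m≤n⇒m≤1+n; m≤m+n; m≤n+m; m<m+n; 0≢1+n; suc-injective
        ; +-suc; +-comm; +-identityʳ; +-mono-≤; +-monoʳ-≤; +-monoˡ-<; +-cancelˡ-≤; +-commutativeSemigroup
        ; m+[n∸m]≡n; m+n∸m≡n; m+n∸n≡m; m∸n+n≡m; [m+n]∸[m+o]≡n∸o; +-∸-comm; +-∸-assoc
        ; m<n⇒0<n∸m; ∸-monoˡ-≤; m≤n⇒m∸n≡0; m∸n≡0⇒m≤n
        ; ≡ᵇ⇒≡; ≡⇒≡ᵇ; ≤ᵇ⇒≤; ≤⇒≤ᵇ; ≤ᵇ-reflects-≤; module ≤-Reasoning )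
open import Data.Nat.Combinatorics using (_C_; nCk+nC[k+1]≡[n+1]C[k+1]; nCk≡nC[n∸k]; k>n⇒nCk≡0)
open import Data.Integer using (+_; _-_)
import Data.Integer as ℤ
import Data.Integer.Properties as ℤ
open import Data.Integer.Solver using (module +-*-Solver)
open import Data.Bool using (Bool; true; false; T; not; _∧_; _∨_; if_then_else_)
open import Data.Bool.Properties using (T-≡; T-∧; T-∨; ∧-assoc; ∧-identityʳ; ∧-zeroʳ)
open import Data.Bool.ListAction using (any; all)
open import Data.Unit using (tt)
open import Data.Empty using (⊥-elim)
open import Data.Product using (∃; ∃₂; _×_; _,_; proj₁; proj₂)
open import Data.Sum using (_⊎_; inj₁; inj₂)
open import Data.Fin using (Fin; zero; suc; _↑ˡ_; _↑ʳ_; splitAt) renaming (_≟_ to _≟ᶠ_)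
open import Data.Fin.Properties
  using (splitAt-↑ˡ; splitAt-↑ʳ; splitAt⁻¹-↑ˡ; splitAt⁻¹-↑ʳ; ↑ˡ-injective; ↑ʳ-injective)
open import Data.Fin.Subset using (⊤; ⊥; ∁)
open import Data.Vec using ([]; _∷_; lookup; _[_]≔_) renaming (_++_ to _++ᵥ_)
import Data.Vec as Vec
open import Data.Vec.Properties using (lookup∘update′; lookup-++ˡ; lookup-++ʳ; lookup-replicate)
open import Data.List using ([]; _∷_; map; allFin; length; filterᵇ; applyUpTo; _++_)
open import Data.List.Properties using (filter-++; length-++)
open import Data.List.Membership.Propositional using (_∈_; lose)
open import Data.List.Membership.Propositional.Properties using (∈-allFin; ∈-map⁺; ∈-++⁺ˡ; ∈-++⁺ʳ)
open import Data.List.Relation.Unary.Any using (here; satisfied)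
open import Data.List.Relation.Unary.Any.Properties using (any⁺; any⁻)
import Data.List.Relation.Unary.All as All
open import Data.List.Relation.Unary.All.Properties using (all⁺; all⁻)
open import Function using (_∘_; _⇔_; mk⇔; Equivalence)
open import Algebra.Properties.CommutativeSemigroup +-commutativeSemigroup
  using () renaming (interchange to +-interchange)
open import Relation.Nullary using (¬_; yes; no; Reflects; ofʸ; ofⁿ; proof)
open import Relation.Binary.Definitions using (tri<; tri≈; tri>)
open import Relation.Nullary.Decidable using (T?; toWitness; fromWitness)
open import Relation.Binary.PropositionalEquality using (_≡_; _≢_; refl; trans; cong; cong₂; subst)
import Relation.Binary.PropositionalEquality as ≡

open Equivalence using (to; from)
open import Function.Properties.Equivalence using () renaming (trans to ⇔-trans; sym to ⇔-sym)

-- Booleans and finite quantifiers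

T-injective : ∀ {x y} → T x ⇔ T y → x ≡ y
T-injective {false} {false} _   = refl
T-injective {false} {true}  x⇔y = ⊥-elim (from x⇔y tt)
T-injective {true}  {false} x⇔y = ⊥-elim (to x⇔y tt)
T-injective {true}  {true}  _   = refl

T-not⇔¬T : ∀ {x} → T (not x) ⇔ (¬ T x)
T-not⇔¬T {false} = mk⇔ (λ _ ()) (λ _ → tt)
T-not⇔¬T {true}  = mk⇔ (λ ()) (λ ¬t → ¬t tt)

T-implies₂ : ∀ a b c → T (not a ∨ not b ∨ c) ⇔ (T a → T b → T c)
T-implies₂ false _     _ = mk⇔ (λ _ ()) (λ _ → tt)
T-implies₂ true  false _ = mk⇔ (λ _ _ ()) (λ _ → tt)
T-implies₂ true  true  c = mk⇔ (λ t _ _ → t) (λ f → f tt tt)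

¬T⇒≡false : ∀ {b} → ¬ T b → b ≡ false
¬T⇒≡false {false} _  = refl
¬T⇒≡false {true}  ¬t = ⊥-elim (¬t tt)

≡ᵇ-reflects-≡ : ∀ m n → Reflects (m ≡ n) (m ≡ᵇ n)
≡ᵇ-reflects-≡ m n = proof (m ≟ n)

≤ᵇ-true : ∀ {m n} → m ≤ n → (m ≤ᵇ n) ≡ true
≤ᵇ-true m≤n = to T-≡ (≤⇒≤ᵇ m≤n)

≤ᵇ-false : ∀ {m n} → n < m → (m ≤ᵇ n) ≡ false
≤ᵇ-false {m} {n} n<m = ¬T⇒≡false (<⇒≱ n<m ∘ ≤ᵇ⇒≤ m n)

≡ᵇ-true : ∀ {m n} → m ≡ n → (m ≡ᵇ n) ≡ true
≡ᵇ-true {m} {n} m≡n = to T-≡ (≡⇒≡ᵇ m n m≡n)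

≡ᵇ-false : ∀ {m n} → m ≢ n → (m ≡ᵇ n) ≡ false
≡ᵇ-false {m} {n} m≢n = ¬T⇒≡false (m≢n ∘ ≡ᵇ⇒≡ m n)

≡ᵇ-shift : ∀ m x i → (m + x ≡ᵇ i) ≡ (m ≤ᵇ i) ∧ (x ≡ᵇ i ∸ m)
≡ᵇ-shift m x i with m ≤ᵇ i | ≤ᵇ-reflects-≤ m i
... | true  | ofʸ m≤i = T-injective (mk⇔
  (λ h → ≡⇒≡ᵇ x (i ∸ m) (trans (≡.sym (m+n∸m≡n m x)) (cong (_∸ m) (≡ᵇ⇒≡ (m + x) i h))))
  (λ h → ≡⇒≡ᵇ (m + x) i (trans (cong (_+_ m) (≡ᵇ⇒≡ x (i ∸ m) h)) (m+[n∸m]≡n m≤i))))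
... | false | ofⁿ m≰i with m + x ≡ᵇ i | ≡ᵇ-reflects-≡ (m + x) i
...   | false | _        = refl
...   | true  | ofʸ m+x≡i = ⊥-elim (m≰i (subst (m ≤_) m+x≡i (m≤m+n m x)))

+-≤ᵇ : ∀ {a f N} k → a + f ≡ N → (k ≤ᵇ f) ≡ (a + k ≤ᵇ N)
+-≤ᵇ {a} {f} {N} k a+f≡N = T-injective (mk⇔
  (λ h → ≤⇒≤ᵇ (subst (a + k ≤_) a+f≡N (+-monoʳ-≤ a (≤ᵇ⇒≤ k f h))))
  (λ h → ≤⇒≤ᵇ (+-cancelˡ-≤ a k f (subst (a + k ≤_) (≡.sym a+f≡N) (≤ᵇ⇒≤ (a + k) N h)))))

any-allFin⇔ : ∀ {n} (p : Fin n → Bool) → T (any p (allFin n)) ⇔ ∃ (T ∘ p)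
any-allFin⇔ p = mk⇔ (satisfied ∘ any⁻ p (allFin _))
                    (λ (x , px) → any⁺ {xs = allFin _} p (lose (∈-allFin x) px))

all-allFin⇔ : ∀ {n} (p : Fin n → Bool) → T (all p (allFin n)) ⇔ (∀ x → T (p x))
all-allFin⇔ p = mk⇔ (λ h x → All.lookup (all⁺ p (allFin _) h) (∈-allFin x))
                    (λ h → all⁻ p {allFin _} (All.tabulate (λ {x} _ → h x)))

∈-allSubsets : ∀ {n} (A : Subset n) → A ∈ allSubsets n
∈-allSubsets []                = here refl
∈-allSubsets (true ∷ A)        = ∈-++⁺ˡ (∈-map⁺ (true ∷_) (∈-allSubsets A))
∈-allSubsets {suc n} (false ∷ A) =
  ∈-++⁺ʳ (map (true ∷_) (allSubsets n)) (∈-map⁺ (false ∷_) (∈-allSubsets A))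

any-allSubsets⇔ : ∀ {n} (p : Subset n → Bool) → T (any p (allSubsets n)) ⇔ ∃ (T ∘ p)
any-allSubsets⇔ p = mk⇔ (satisfied ∘ any⁻ p (allSubsets _))
                        (λ (A , pA) → any⁺ {xs = allSubsets _} p (lose (∈-allSubsets A) pA))

-- Cardinality and disjointness of subsets

card≤n : ∀ {n} (S : Subset n) → card S ≤ n
card≤n []          = z≤n
card≤n (true ∷ S)  = s≤s (card≤n S)
card≤n (false ∷ S) = m≤n⇒m≤1+n (card≤n S)

card-remove : ∀ {n} (S : Subset n) {x} → T (x ∈ᵇ S) → suc (card (S [ x ]≔ false)) ≡ card S
card-remove (true ∷ S)  {zero}  _  = refl
card-remove (true ∷ S)  {suc x} xS = cong suc (card-remove S xS)
card-remove (false ∷ S) {suc x} xS = card-remove S xS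

∈-remove⁺ : ∀ {n} (S : Subset n) {x w} → w ≢ x → T (w ∈ᵇ S) → T (w ∈ᵇ (S [ x ]≔ false))
∈-remove⁺ S w≢x = subst T (≡.sym (lookup∘update′ w≢x S false))

∈-remove⁻ : ∀ {n} (S : Subset n) {x w} → T (w ∈ᵇ (S [ x ]≔ false)) → T (w ∈ᵇ S)
∈-remove⁻ (b ∷ S) {zero}  {zero}  ()
∈-remove⁻ (b ∷ S) {zero}  {suc w} wS = wS
∈-remove⁻ (b ∷ S) {suc x} {zero}  wS = wS
∈-remove⁻ (b ∷ S) {suc x} {suc w} wS = ∈-remove⁻ S wS

card-++ : ∀ {n₁ n₂} (A : Subset n₁) (B : Subset n₂) → card (A ++ᵥ B) ≡ card A + card B
card-++ []          B = refl
card-++ (true ∷ A)  B = cong suc (card-++ A B)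
card-++ (false ∷ A) B = card-++ A B

card-⊥ : ∀ n → card (⊥ {n}) ≡ 0
card-⊥ zero    = refl
card-⊥ (suc n) = card-⊥ n

card-⊤ : ∀ n → card (⊤ {n}) ≡ n
card-⊤ zero    = refl
card-⊤ (suc n) = cong suc (card-⊤ n)

card+card-∁ : ∀ {n} (A : Subset n) → card A + card (∁ A) ≡ n
card+card-∁ []          = refl
card+card-∁ (true ∷ A)  = cong suc (card+card-∁ A)
card+card-∁ (false ∷ A) = trans (+-suc (card A) _) (cong suc (card+card-∁ A))

card≢n⇒0<card-∁ : ∀ {n} (A : Subset n) → card A ≢ n → 0 < card (∁ A)
card≢n⇒0<card-∁ []          0≢0 = ⊥-elim (0≢0 refl)
card≢n⇒0<card-∁ (true ∷ A)  c≢n = card≢n⇒0<card-∁ A (c≢n ∘ cong suc)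
card≢n⇒0<card-∁ (false ∷ A) _   = s≤s z≤n

0<card⇒nonempty : ∀ {n} (τ : Subset n) → 0 < card τ → ∃ λ x → T (x ∈ᵇ τ)
0<card⇒nonempty (true ∷ τ)  _   = zero , tt
0<card⇒nonempty (false ∷ τ) pos = let x , x∈τ = 0<card⇒nonempty τ pos in suc x , x∈τ

disjointᵇ-++ : ∀ {n₁ n₂} (τ₁ A : Subset n₁) (τ₂ B : Subset n₂) →
               disjointᵇ (τ₁ ++ᵥ τ₂) (A ++ᵥ B) ≡ disjointᵇ τ₁ A ∧ disjointᵇ τ₂ B
disjointᵇ-++ []      []      τ₂ B = refl
disjointᵇ-++ (t ∷ τ₁) (a ∷ A) τ₂ B =
  trans (cong (not (t ∧ a) ∧_) (disjointᵇ-++ τ₁ A τ₂ B)) (≡.sym (∧-assoc (not (t ∧ a)) _ _))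

disjointᵇ-⊥ : ∀ {n} (X : Subset n) → disjointᵇ ⊥ X ≡ true
disjointᵇ-⊥ []      = refl
disjointᵇ-⊥ (_ ∷ X) = disjointᵇ-⊥ X

disjoint⇒card≤card-∁ : ∀ {n} (τ X : Subset n) → T (disjointᵇ τ X) → card τ ≤ card (∁ X)
disjoint⇒card≤card-∁ []          []          _ = z≤n
disjoint⇒card≤card-∁ (true ∷ τ)  (false ∷ X) d = s≤s (disjoint⇒card≤card-∁ τ X d)
disjoint⇒card≤card-∁ (false ∷ τ) (true ∷ X)  d = disjoint⇒card≤card-∁ τ X d
disjoint⇒card≤card-∁ (false ∷ τ) (false ∷ X) d = m≤n⇒m≤1+n (disjoint⇒card≤card-∁ τ X d)

disjoint-full⇒≡⊥ : ∀ {n} (τ X : Subset n) → card X ≡ n → T (disjointᵇ τ X) → τ ≡ ⊥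
disjoint-full⇒≡⊥ []          []          _  _ = refl
disjoint-full⇒≡⊥ (false ∷ τ) (true ∷ X)  eq d = cong (false ∷_) (disjoint-full⇒≡⊥ τ X (suc-injective eq) d)
disjoint-full⇒≡⊥ (_ ∷ τ)     (false ∷ X) eq _ = ⊥-elim (<-irrefl eq (s≤s (card≤n X)))

choose-disjoint : ∀ {n} j (X : Subset n) → j ≤ card (∁ X) →
                  ∃ λ τ → card τ ≡ j × T (disjointᵇ τ X)
choose-disjoint {n} zero X         _         = ⊥ , card-⊥ n , subst T (≡.sym (disjointᵇ-⊥ X)) tt
choose-disjoint (suc j) (true ∷ X)  1+j≤c     =
  let τ , card≡ , d = choose-disjoint (suc j) X 1+j≤c in false ∷ τ , card≡ , d
choose-disjoint (suc j) (false ∷ X) (s≤s j≤c) =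
  let τ , card≡ , d = choose-disjoint j X j≤c in true ∷ τ , cong suc card≡ , d

positive-split : ∀ {k a b} → 2 ≤ k → 0 < a → 0 < b → k ≤ a + b →
                 ∃₂ λ k₁ k₂ → k₁ + k₂ ≡ k × 0 < k₁ × k₁ ≤ a × 0 < k₂ × k₂ ≤ b
positive-split {suc k} {a} {b} (s≤s 0<k) 0<a 0<b 1+k≤a+b with k ≤? a
... | yes k≤a = k , 1 , +-comm k 1 , 0<k , k≤a , s≤s z≤n , 0<b
... | no  k≰a = a , suc k ∸ a , m+[n∸m]≡n (<⇒≤ a<1+k) , 0<a , ≤-refl , m<n⇒0<n∸m a<1+k ,
                ≤-trans (∸-monoˡ-≤ a 1+k≤a+b) (≤-reflexive (m+n∸m≡n a b))
  where
  a<1+k : a < suc k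
  a<1+k = s≤s (<⇒≤ (≰⇒> k≰a))

-- Walks and connectivity

data Walk {n} (G : Graph n) (S : Subset n) : Fin n → Fin n → ℕ → Set where
  stop : ∀ {v} → Walk G S v v 0
  step : ∀ {u w v l} → T (w ∈ᵇ S) → T (adj G u w) → Walk G S w v l → Walk G S u v (suc l)

Connected : ∀ {n} → Graph n → Subset n → Set
Connected G S = ∀ {u v} → T (u ∈ᵇ S) → T (v ∈ᵇ S) → ∃ λ l → Walk G S u v l

module _ {n} {G : Graph n} where

  walkᵇ⇒Walk : ∀ {S} m {u v} → T (walkᵇ G S m u v) → ∃ λ l → l ≤ m × Walk G S u v l
  walkᵇ⇒Walk zero h with toWitness h
  ... | refl = 0 , z≤n , stop
  walkᵇ⇒Walk (suc m) {u} {v} h with u ≟ᶠ v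
  ... | yes refl = 0 , z≤n , stop
  ... | no _ with to (any-allFin⇔ {n} _) h
  ...   | w , h′ with to T-∧ h′
  ...     | wS , h″ with to T-∧ h″
  ...       | uw , rest with walkᵇ⇒Walk m rest
  ...         | l , l≤m , W = suc l , s≤s l≤m , step wS uw W

  Walk⇒walkᵇ : ∀ {S} m {u v l} → l ≤ m → Walk G S u v l → T (walkᵇ G S m u v)
  Walk⇒walkᵇ zero    _          (stop {v}) = fromWitness {a? = v ≟ᶠ v} refl
  Walk⇒walkᵇ (suc m) _          (stop {v}) with v ≟ᶠ v
  ... | yes _  = tt
  ... | no v≢v = ⊥-elim (v≢v refl)
  Walk⇒walkᵇ (suc m) (s≤s l≤m) (step {w = w} wS uw W) =
    from T-∨ (inj₂ (from (any-allFin⇔ {n} _) (w , from T-∧ (wS , from T-∧ (uw , Walk⇒walkᵇ m l≤m W)))))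

  weaken : ∀ {S S′} → (∀ {w} → T (w ∈ᵇ S) → T (w ∈ᵇ S′)) →
           ∀ {u v l} → Walk G S u v l → Walk G S′ u v l
  weaken S⊆S′ stop           = stop
  weaken S⊆S′ (step wS uw W) = step (S⊆S′ wS) uw (weaken S⊆S′ W)

  suffix⊎avoiding : ∀ {S} x {u v l} → Walk G S u v l →
                    (∃ λ l′ → l′ ≤ l × Walk G S x v l′) ⊎ (u ≢ x × Walk G (S [ x ]≔ false) u v l)
  suffix⊎avoiding x {u} stop with u ≟ᶠ x
  ... | yes refl = inj₁ (0 , z≤n , stop)
  ... | no u≢x   = inj₂ (u≢x , stop)
  suffix⊎avoiding {S} x {u} (step wS uw W) with u ≟ᶠ x
  ... | yes refl = inj₁ (_ , ≤-refl , step wS uw W)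
  ... | no u≢x with suffix⊎avoiding x W
  ...   | inj₁ (l′ , l′≤l , W′) = inj₁ (l′ , m≤n⇒m≤1+n l′≤l , W′)
  ...   | inj₂ (w≢x , W′)      = inj₂ (u≢x , step (∈-remove⁺ S w≢x wS) uw W′)

  -- Either the rest of the walk comes back to u, and we restart from there, or it
  -- avoids u and is a walk inside S ∖ {u}, which has one vertex fewer.
  shorten : ∀ fuel {S u v l} → l ≤ fuel → T (u ∈ᵇ S) → Walk G S u v l →
            ∃ λ l′ → l′ < card S × Walk G S u v l′
  shorten _ {S} _ uS stop = 0 , subst (0 <_) (card-remove S uS) (s≤s z≤n) , stop
  shorten (suc fuel) {S} {u} (s≤s l≤fuel) uS (step wS uw W) with suffix⊎avoiding u W
  ... | inj₁ (l′ , l′≤l , W′) = shorten fuel (≤-trans l′≤l l≤fuel) uS W′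
  ... | inj₂ (w≢u , W′) with shorten fuel l≤fuel (∈-remove⁺ S w≢u wS) W′
  ...   | l′ , l′<card , W″ =
    suc l′ , subst (suc l′ <_) (card-remove S uS) (s≤s l′<card) , step wS uw (weaken (∈-remove⁻ S) W″)

  connectedᵇ⇔ : ∀ {S} → T (connectedᵇ G S) ⇔ Connected G S
  connectedᵇ⇔ {S} = mk⇔ sound complete
    where
    sound : T (connectedᵇ G S) → Connected G S
    sound h {u} {v} uS vS =
      let path? = to (T-implies₂ _ _ _) (to (all-allFin⇔ {n} _) (to (all-allFin⇔ {n} _) h u) v)
          l , _ , W = walkᵇ⇒Walk n (path? uS vS)
      in l , W
    complete : Connected G S → T (connectedᵇ G S)
    complete conn =
      from (all-allFin⇔ {n} _) λ u → from (all-allFin⇔ {n} _) λ v → from (T-implies₂ _ _ _) λ uS vS →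
      let l , W = conn uS vS
          l′ , l′<card , W′ = shorten l ≤-refl uS W
      in Walk⇒walkᵇ n (≤-trans (n≤1+n l′) (≤-trans l′<card (card≤n S))) W′

module Embedding {m n} {H : Graph m} {G : Graph n} (e : Fin m → Fin n)
                 (e-injective : ∀ {a b} → e a ≡ e b → a ≡ b)
                 (adj-e : ∀ a b → adj G (e a) (e b) ≡ adj H a b)
                 {R : Subset m} {S : Subset n}
                 (∈-e : ∀ a → e a ∈ᵇ S ≡ a ∈ᵇ R)
                 (S⊆image : ∀ {w} → T (w ∈ᵇ S) → ∃ λ a → e a ≡ w) where

  push : ∀ {a b l} → Walk H R a b l → Walk G S (e a) (e b) l
  push stop                        = stop
  push (step {u = a} {w = c} cR ac W) =
    step (subst T (≡.sym (∈-e c)) cR) (subst T (≡.sym (adj-e a c)) ac) (push W)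

  pull : ∀ {a b w l} → Walk G S (e a) w l → e b ≡ w → Walk H R a b l
  pull stop eb≡ea with e-injective eb≡ea
  ... | refl = stop
  pull {a} (step wS aw W) eb≡v with S⊆image wS
  ... | c , refl = step (subst T (∈-e c) wS) (subst T (adj-e a c) aw) (pull W eb≡v)

  connected⇔ : Connected G S ⇔ Connected H R
  connected⇔ = mk⇔ restrict extend
    where
    restrict : Connected G S → Connected H R
    restrict conn {a} {b} aR bR =
      let l , W = conn (subst T (≡.sym (∈-e a)) aR) (subst T (≡.sym (∈-e b)) bR) in l , pull W refl
    extend : Connected H R → Connected G S
    extend conn uS vS with S⊆image uS | S⊆image vS
    ... | a , refl | b , refl =
      let l , W = conn (subst T (∈-e a) uS) (subst T (∈-e b) vS) in l , push W

-- Cut faces of a disjoint union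

↑ˡ⊎↑ʳ : ∀ m {n} (w : Fin (m + n)) → (∃ λ a → a ↑ˡ n ≡ w) ⊎ (∃ λ b → m ↑ʳ b ≡ w)
↑ˡ⊎↑ʳ m w with splitAt m w in eq
... | inj₁ a = inj₁ (a , splitAt⁻¹-↑ˡ eq)
... | inj₂ b = inj₂ (b , splitAt⁻¹-↑ʳ eq)

↑ˡ≢↑ʳ : ∀ {m n} (a : Fin m) (b : Fin n) → a ↑ˡ n ≢ m ↑ʳ b
↑ˡ≢↑ʳ {m} {n} a b eq with trans (≡.sym (splitAt-↑ˡ m a n)) (trans (cong (splitAt m) eq) (splitAt-↑ʳ m n b))
... | ()

module _ {n₁ n₂} (G₁ : Graph n₁) (G₂ : Graph n₂) where

  adj-↑ˡ : ∀ a b → adj (G₁ ⊕ G₂) (a ↑ˡ n₂) (b ↑ˡ n₂) ≡ adj G₁ a b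
  adj-↑ˡ a b rewrite splitAt-↑ˡ n₁ a n₂ | splitAt-↑ˡ n₁ b n₂ = refl

  adj-↑ʳ : ∀ a b → adj (G₁ ⊕ G₂) (n₁ ↑ʳ a) (n₁ ↑ʳ b) ≡ adj G₂ a b
  adj-↑ʳ a b rewrite splitAt-↑ʳ n₁ n₂ a | splitAt-↑ʳ n₁ n₂ b = refl

  adj-↑ˡ-↑ʳ : ∀ a b → adj (G₁ ⊕ G₂) (a ↑ˡ n₂) (n₁ ↑ʳ b) ≡ false
  adj-↑ˡ-↑ʳ a b rewrite splitAt-↑ˡ n₁ a n₂ | splitAt-↑ʳ n₁ n₂ b = refl

  connectedᵇ-⊕ˡ : ∀ τ₁ → connectedᵇ (G₁ ⊕ G₂) (τ₁ ++ᵥ ⊥) ≡ connectedᵇ G₁ τ₁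
  connectedᵇ-⊕ˡ τ₁ = T-injective (⇔-trans connectedᵇ⇔ (⇔-trans Left.connected⇔ (⇔-sym connectedᵇ⇔)))
    where
    image : ∀ {w} → T (w ∈ᵇ (τ₁ ++ᵥ ⊥)) → ∃ λ a → a ↑ˡ n₂ ≡ w
    image {w} wS with ↑ˡ⊎↑ʳ n₁ w
    ... | inj₁ preimage = preimage
    ... | inj₂ (b , refl) = ⊥-elim (subst T (trans (lookup-++ʳ τ₁ ⊥ b) (lookup-replicate b false)) wS)
    module Left = Embedding {H = G₁} {G = G₁ ⊕ G₂} (_↑ˡ n₂) (↑ˡ-injective n₂ _ _) adj-↑ˡ
                          {R = τ₁} {S = τ₁ ++ᵥ ⊥} (lookup-++ˡ τ₁ ⊥) image

  connectedᵇ-⊕ʳ : ∀ τ₂ → connectedᵇ (G₁ ⊕ G₂) (⊥ ++ᵥ τ₂) ≡ connectedᵇ G₂ τ₂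
  connectedᵇ-⊕ʳ τ₂ = T-injective (⇔-trans connectedᵇ⇔ (⇔-trans Right.connected⇔ (⇔-sym connectedᵇ⇔)))
    where
    image : ∀ {w} → T (w ∈ᵇ (⊥ ++ᵥ τ₂)) → ∃ λ b → n₁ ↑ʳ b ≡ w
    image {w} wS with ↑ˡ⊎↑ʳ n₁ w
    ... | inj₂ preimage = preimage
    ... | inj₁ (a , refl) = ⊥-elim (subst T (trans (lookup-++ˡ (⊥ {n₁}) τ₂ a) (lookup-replicate a false)) wS)
    module Right = Embedding {H = G₂} {G = G₁ ⊕ G₂} (n₁ ↑ʳ_) (↑ʳ-injective n₁ _ _) adj-↑ʳ
                           {R = τ₂} {S = ⊥ {n₁} ++ᵥ τ₂} (lookup-++ʳ (⊥ {n₁}) τ₂) image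

  walk-from-↑ˡ : ∀ {S a w l} → Walk (G₁ ⊕ G₂) S (a ↑ˡ n₂) w l → ∃ λ c → c ↑ˡ n₂ ≡ w
  walk-from-↑ˡ {a = a} stop = a , refl
  walk-from-↑ˡ {a = a} (step {w = w} _ aw W) with ↑ˡ⊎↑ʳ n₁ w
  ... | inj₁ (c , refl) = walk-from-↑ˡ W
  ... | inj₂ (c , refl) = ⊥-elim (subst T (adj-↑ˡ-↑ʳ a c) aw)

  ¬connected-⊕ : ∀ {τ₁ τ₂ a b} → T (a ∈ᵇ τ₁) → T (b ∈ᵇ τ₂) → ¬ T (connectedᵇ (G₁ ⊕ G₂) (τ₁ ++ᵥ τ₂))
  ¬connected-⊕ {τ₁} {τ₂} {a} {b} aT bT conn
    with to (connectedᵇ⇔ {S = τ₁ ++ᵥ τ₂}) conn (subst T (≡.sym (lookup-++ˡ τ₁ τ₂ a)) aT)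
                                               (subst T (≡.sym (lookup-++ʳ τ₁ τ₂ b)) bT)
  ... | _ , W with walk-from-↑ˡ W
  ...   | c , c↑ˡ≡b↑ʳ = ↑ˡ≢↑ʳ c b c↑ˡ≡b↑ʳ

cutSetᵇ : ∀ {n} → ℕ → Graph n → Subset n → Subset n → Bool
cutSetᵇ k G σ τ = (card τ ≡ᵇ k) ∧ disjointᵇ τ σ ∧ not (connectedᵇ G τ)

cutSetᵇ⇔ : ∀ {n} k (G : Graph n) σ τ →
           T (cutSetᵇ k G σ τ) ⇔ (card τ ≡ k × T (disjointᵇ τ σ) × ¬ T (connectedᵇ G τ))
cutSetᵇ⇔ k G σ τ = mk⇔
  (λ cut → let c , r = to T-∧ cut ; d , ¬conn = to T-∧ r in ≡ᵇ⇒≡ (card τ) k c , d , to T-not⇔¬T ¬conn)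
  (λ (c , d , ¬conn) → from T-∧ (≡⇒≡ᵇ (card τ) k c , from T-∧ (d , from T-not⇔¬T ¬conn)))

isCutFaceᵇ⇔ : ∀ {n} k (G : Graph n) σ → T (isCutFaceᵇ k G σ) ⇔ ∃ λ τ → T (cutSetᵇ k G σ τ)
isCutFaceᵇ⇔ k G σ = any-allSubsets⇔ (cutSetᵇ k G σ)

¬isCutFaceᵇ-full : ∀ {n k} {G : Graph n} {σ} → 0 < k → card σ ≡ n → ¬ T (isCutFaceᵇ k G σ)
¬isCutFaceᵇ-full {n} {k} {G} {σ} 0<k full face with to (isCutFaceᵇ⇔ k G σ) face
... | τ , cut with to (cutSetᵇ⇔ k G σ τ) cut
...   | card≡k , d , _ with disjoint-full⇒≡⊥ τ σ full d
...     | refl = <-irrefl (trans (≡.sym (card-⊥ n)) card≡k) 0<k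

module _ (k : ℕ) {n₁ n₂} (G₁ : Graph n₁) (G₂ : Graph n₂) (A : Subset n₁) (B : Subset n₂) where

  cutSetᵇ-⊕ˡ : ∀ τ₁ → cutSetᵇ k (G₁ ⊕ G₂) (A ++ᵥ B) (τ₁ ++ᵥ ⊥) ≡ cutSetᵇ k G₁ A τ₁
  cutSetᵇ-⊕ˡ τ₁ = cong₂ _∧_
    (cong (_≡ᵇ k) (trans (card-++ τ₁ ⊥) (trans (cong (_+_ (card τ₁)) (card-⊥ n₂)) (+-identityʳ _))))
    (cong₂ _∧_ (trans (disjointᵇ-++ τ₁ A ⊥ B)
                      (trans (cong (disjointᵇ τ₁ A ∧_) (disjointᵇ-⊥ B)) (∧-identityʳ _)))
               (cong not (connectedᵇ-⊕ˡ G₁ G₂ τ₁)))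

  cutSetᵇ-⊕ʳ : ∀ τ₂ → cutSetᵇ k (G₁ ⊕ G₂) (A ++ᵥ B) (⊥ ++ᵥ τ₂) ≡ cutSetᵇ k G₂ B τ₂
  cutSetᵇ-⊕ʳ τ₂ = cong₂ _∧_
    (cong (_≡ᵇ k) (trans (card-++ (⊥ {n₁}) τ₂) (cong (_+ card τ₂) (card-⊥ n₁))))
    (cong₂ _∧_ (trans (disjointᵇ-++ ⊥ A τ₂ B) (cong (_∧ disjointᵇ τ₂ B) (disjointᵇ-⊥ A)))
               (cong not (connectedᵇ-⊕ʳ G₁ G₂ τ₂)))

  cutSet-⊕-disjoint : ∀ τ₁ τ₂ → T (cutSetᵇ k (G₁ ⊕ G₂) (A ++ᵥ B) (τ₁ ++ᵥ τ₂)) →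
                      T (disjointᵇ τ₁ A) × T (disjointᵇ τ₂ B)
  cutSet-⊕-disjoint τ₁ τ₂ cut =
    let _ , disjoint , _ = to (cutSetᵇ⇔ k (G₁ ⊕ G₂) (A ++ᵥ B) (τ₁ ++ᵥ τ₂)) cut
    in to T-∧ (subst T (disjointᵇ-++ τ₁ A τ₂ B) disjoint)

  isCutFaceᵇ-⊕-fullʳ : card B ≡ n₂ → isCutFaceᵇ k (G₁ ⊕ G₂) (A ++ᵥ B) ≡ isCutFaceᵇ k G₁ A
  isCutFaceᵇ-⊕-fullʳ full =
    T-injective (⇔-trans (isCutFaceᵇ⇔ k _ _) (⇔-trans (mk⇔ restrict extend) (⇔-sym (isCutFaceᵇ⇔ k _ _))))
    where
    restrict : (∃ λ τ → T (cutSetᵇ k (G₁ ⊕ G₂) (A ++ᵥ B) τ)) → ∃ λ τ₁ → T (cutSetᵇ k G₁ A τ₁)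
    restrict (τ , cut) with Vec.splitAt n₁ τ
    ... | τ₁ , τ₂ , refl with disjoint-full⇒≡⊥ τ₂ B full (proj₂ (cutSet-⊕-disjoint τ₁ τ₂ cut))
    ...   | refl = τ₁ , subst T (cutSetᵇ-⊕ˡ τ₁) cut
    extend : (∃ λ τ₁ → T (cutSetᵇ k G₁ A τ₁)) → ∃ λ τ → T (cutSetᵇ k (G₁ ⊕ G₂) (A ++ᵥ B) τ)
    extend (τ₁ , cut) = τ₁ ++ᵥ ⊥ , subst T (≡.sym (cutSetᵇ-⊕ˡ τ₁)) cut

  isCutFaceᵇ-⊕-fullˡ : card A ≡ n₁ → isCutFaceᵇ k (G₁ ⊕ G₂) (A ++ᵥ B) ≡ isCutFaceᵇ k G₂ B
  isCutFaceᵇ-⊕-fullˡ full =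
    T-injective (⇔-trans (isCutFaceᵇ⇔ k _ _) (⇔-trans (mk⇔ restrict extend) (⇔-sym (isCutFaceᵇ⇔ k _ _))))
    where
    restrict : (∃ λ τ → T (cutSetᵇ k (G₁ ⊕ G₂) (A ++ᵥ B) τ)) → ∃ λ τ₂ → T (cutSetᵇ k G₂ B τ₂)
    restrict (τ , cut) with Vec.splitAt n₁ τ
    ... | τ₁ , τ₂ , refl with disjoint-full⇒≡⊥ τ₁ A full (proj₁ (cutSet-⊕-disjoint τ₁ τ₂ cut))
    ...   | refl = τ₂ , subst T (cutSetᵇ-⊕ʳ τ₂) cut
    extend : (∃ λ τ₂ → T (cutSetᵇ k G₂ B τ₂)) → ∃ λ τ → T (cutSetᵇ k (G₁ ⊕ G₂) (A ++ᵥ B) τ)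
    extend (τ₂ , cut) = ⊥ ++ᵥ τ₂ , subst T (≡.sym (cutSetᵇ-⊕ʳ τ₂)) cut

  -- A k-set meeting both sides of G₁ ⊕ G₂ is disconnected, so only the size of the
  -- complement matters.
  isCutFaceᵇ-⊕-proper : 2 ≤ k → card A ≢ n₁ → card B ≢ n₂ →
                        isCutFaceᵇ k (G₁ ⊕ G₂) (A ++ᵥ B) ≡ (k ≤ᵇ card (∁ A) + card (∁ B))
  isCutFaceᵇ-⊕-proper 2≤k A≢full B≢full = T-injective (⇔-trans (isCutFaceᵇ⇔ k _ _) (mk⇔ bound build))
    where
    bound : (∃ λ τ → T (cutSetᵇ k (G₁ ⊕ G₂) (A ++ᵥ B) τ)) → T (k ≤ᵇ card (∁ A) + card (∁ B))
    bound (τ , cut) with Vec.splitAt n₁ τ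
    ... | τ₁ , τ₂ , refl =
      let card≡k , _ = to (cutSetᵇ⇔ k (G₁ ⊕ G₂) (A ++ᵥ B) (τ₁ ++ᵥ τ₂)) cut
          d₁ , d₂ = cutSet-⊕-disjoint τ₁ τ₂ cut
      in ≤⇒≤ᵇ (subst (_≤ card (∁ A) + card (∁ B)) (trans (≡.sym (card-++ τ₁ τ₂)) card≡k)
                     (+-mono-≤ (disjoint⇒card≤card-∁ τ₁ A d₁) (disjoint⇒card≤card-∁ τ₂ B d₂)))
    build : T (k ≤ᵇ card (∁ A) + card (∁ B)) → ∃ λ τ → T (cutSetᵇ k (G₁ ⊕ G₂) (A ++ᵥ B) τ)
    build k≤ with positive-split 2≤k (card≢n⇒0<card-∁ A A≢full) (card≢n⇒0<card-∁ B B≢full)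
                                     (≤ᵇ⇒≤ k (card (∁ A) + card (∁ B)) k≤)
    ... | k₁ , k₂ , k₁+k₂≡k , 0<k₁ , k₁≤ , 0<k₂ , k₂≤
        with choose-disjoint k₁ A k₁≤ | choose-disjoint k₂ B k₂≤
    ...   | τ₁ , card₁ , d₁ | τ₂ , card₂ , d₂
          with 0<card⇒nonempty τ₁ (subst (0 <_) (≡.sym card₁) 0<k₁)
             | 0<card⇒nonempty τ₂ (subst (0 <_) (≡.sym card₂) 0<k₂)
    ...     | _ , a∈τ₁ | _ , b∈τ₂ = τ₁ ++ᵥ τ₂ , from (cutSetᵇ⇔ k (G₁ ⊕ G₂) (A ++ᵥ B) (τ₁ ++ᵥ τ₂))
      ( trans (card-++ τ₁ τ₂) (trans (cong₂ _+_ card₁ card₂) k₁+k₂≡k)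
      , subst T (≡.sym (disjointᵇ-++ τ₁ A τ₂ B)) (from T-∧ (d₁ , d₂))
      , ¬connected-⊕ G₁ G₂ {τ₁} {τ₂} a∈τ₁ b∈τ₂ )

  isCutFaceᵇ-⊕ : 2 ≤ k →
    isCutFaceᵇ k (G₁ ⊕ G₂) (A ++ᵥ B) ≡
      (if card B ≡ᵇ n₂ then isCutFaceᵇ k G₁ A
       else if card A ≡ᵇ n₁ then isCutFaceᵇ k G₂ B
       else k ≤ᵇ card (∁ A) + card (∁ B))
  isCutFaceᵇ-⊕ 2≤k with card B ≡ᵇ n₂ | ≡ᵇ-reflects-≡ (card B) n₂
  ... | true  | ofʸ B-full  = isCutFaceᵇ-⊕-fullʳ B-full
  ... | false | ofⁿ B≢full with card A ≡ᵇ n₁ | ≡ᵇ-reflects-≡ (card A) n₁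
  ...   | true  | ofʸ A-full  = isCutFaceᵇ-⊕-fullˡ A-full
  ...   | false | ofⁿ A≢full = isCutFaceᵇ-⊕-proper 2≤k A≢full B≢full

-- Sums over subsets

⟦_⟧ : Bool → ℕ
⟦ true  ⟧ = 1
⟦ false ⟧ = 0

sumSubsets : ∀ n → (Subset n → ℕ) → ℕ
sumSubsets zero    f = f []
sumSubsets (suc n) f = sumSubsets n (f ∘ (true ∷_)) + sumSubsets n (f ∘ (false ∷_))

sumSubsets-cong : ∀ n {f g : Subset n → ℕ} → (∀ A → f A ≡ g A) → sumSubsets n f ≡ sumSubsets n g
sumSubsets-cong zero    f≗g = f≗g []
sumSubsets-cong (suc n) f≗g =
  cong₂ _+_ (sumSubsets-cong n (f≗g ∘ (true ∷_))) (sumSubsets-cong n (f≗g ∘ (false ∷_)))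

sumSubsets-zero : ∀ n → sumSubsets n (λ _ → 0) ≡ 0
sumSubsets-zero zero    = refl
sumSubsets-zero (suc n) = cong₂ _+_ (sumSubsets-zero n) (sumSubsets-zero n)

sumSubsets-+ : ∀ n (f g : Subset n → ℕ) →
               sumSubsets n (λ A → f A + g A) ≡ sumSubsets n f + sumSubsets n g
sumSubsets-+ zero    f g = refl
sumSubsets-+ (suc n) f g =
  trans (cong₂ _+_ (sumSubsets-+ n (f ∘ (true ∷_)) (g ∘ (true ∷_)))
                   (sumSubsets-+ n (f ∘ (false ∷_)) (g ∘ (false ∷_))))
        (+-interchange (Σ (f ∘ (true ∷_))) (Σ (g ∘ (true ∷_))) (Σ (f ∘ (false ∷_))) (Σ (g ∘ (false ∷_))))
  where
  Σ : (Subset n → ℕ) → ℕ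
  Σ = sumSubsets n

sumSubsets-++ : ∀ n₁ n₂ (f : Subset (n₁ + n₂) → ℕ) →
                sumSubsets (n₁ + n₂) f ≡ sumSubsets n₁ (λ A → sumSubsets n₂ (λ B → f (A ++ᵥ B)))
sumSubsets-++ zero     n₂ f = refl
sumSubsets-++ (suc n₁) n₂ f = cong₂ _+_ (sumSubsets-++ n₁ n₂ _) (sumSubsets-++ n₁ n₂ _)

sumSubsets-if : ∀ n b (f : Subset n → ℕ) →
                sumSubsets n (λ A → if b then f A else 0) ≡ (if b then sumSubsets n f else 0)
sumSubsets-if n true  f = refl
sumSubsets-if n false f = sumSubsets-zero n

sumSubsets-∧ : ∀ n b (p : Subset n → Bool) →
               sumSubsets n (λ A → ⟦ b ∧ p A ⟧) ≡ (if b then sumSubsets n (⟦_⟧ ∘ p) else 0)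
sumSubsets-∧ n true  p = refl
sumSubsets-∧ n false p = sumSubsets-zero n

sumSubsets-full : ∀ n (f : Subset n → ℕ) → sumSubsets n (λ A → if card A ≡ᵇ n then f A else 0) ≡ f ⊤
sumSubsets-full zero    f = refl
sumSubsets-full (suc n) f =
  trans (cong₂ _+_ (sumSubsets-full n (f ∘ (true ∷_))) (trans (sumSubsets-cong n vanish) (sumSubsets-zero n)))
        (+-identityʳ _)
  where
  vanish : ∀ A → (if card A ≡ᵇ suc n then f (false ∷ A) else 0) ≡ 0
  vanish A with card A ≡ᵇ suc n | ≡ᵇ-reflects-≡ (card A) (suc n)
  ... | false | _        = refl
  ... | true  | ofʸ full = ⊥-elim (<-irrefl full (s≤s (card≤n A)))

sumSubsets-card : ∀ n j → sumSubsets n (λ A → ⟦ card A ≡ᵇ j ⟧) ≡ n C j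
sumSubsets-card zero    zero    = refl
sumSubsets-card zero    (suc j) = refl
sumSubsets-card (suc n) zero    = cong₂ _+_ (sumSubsets-zero n) (sumSubsets-card n zero)
sumSubsets-card (suc n) (suc j) =
  trans (cong₂ _+_ (sumSubsets-card n j) (sumSubsets-card n (suc j))) (nCk+nC[k+1]≡[n+1]C[k+1] n j)

length-filterᵇ-map : ∀ {A B : Set} (p : B → Bool) (f : A → B) xs →
                     length (filterᵇ p (map f xs)) ≡ length (filterᵇ (p ∘ f) xs)
length-filterᵇ-map p f []       = refl
length-filterᵇ-map p f (x ∷ xs) with p (f x)
... | true  = cong suc (length-filterᵇ-map p f xs)
... | false = length-filterᵇ-map p f xs

length-filterᵇ-allSubsets : ∀ n (p : Subset n → Bool) →
                            length (filterᵇ p (allSubsets n)) ≡ sumSubsets n (⟦_⟧ ∘ p)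
length-filterᵇ-allSubsets zero    p with p []
... | true  = refl
... | false = refl
length-filterᵇ-allSubsets (suc n) p = begin
  length (filterᵇ p (map (true ∷_) (allSubsets n) ++ map (false ∷_) (allSubsets n)))
    ≡⟨ cong length (filter-++ (T? ∘ p) (map (true ∷_) (allSubsets n)) _) ⟩
  length (filterᵇ p (map (true ∷_) (allSubsets n)) ++ filterᵇ p (map (false ∷_) (allSubsets n)))
    ≡⟨ length-++ (filterᵇ p (map (true ∷_) (allSubsets n))) ⟩
  length (filterᵇ p (map (true ∷_) (allSubsets n))) + length (filterᵇ p (map (false ∷_) (allSubsets n)))
    ≡⟨ cong₂ _+_ (length-filterᵇ-map p _ (allSubsets n)) (length-filterᵇ-map p _ (allSubsets n)) ⟩
  length (filterᵇ (p ∘ (true ∷_)) (allSubsets n)) + length (filterᵇ (p ∘ (false ∷_)) (allSubsets n))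
    ≡⟨ cong₂ _+_ (length-filterᵇ-allSubsets n _) (length-filterᵇ-allSubsets n _) ⟩
  sumSubsets (suc n) (⟦_⟧ ∘ p) ∎
  where open ≡.≡-Reasoning

sumSubsets-shift : ∀ n m i (p : Subset n → Bool) →
  sumSubsets n (λ A → ⟦ (m + card A ≡ᵇ i) ∧ p A ⟧) ≡
    (if m ≤ᵇ i then sumSubsets n (λ A → ⟦ (card A ≡ᵇ i ∸ m) ∧ p A ⟧) else 0)
sumSubsets-shift n m i p =
  trans (sumSubsets-cong n λ A →
           cong ⟦_⟧ (trans (cong (_∧ p A) (≡ᵇ-shift m (card A) i)) (∧-assoc (m ≤ᵇ i) _ _)))
        (sumSubsets-∧ n (m ≤ᵇ i) _)

sumSubsets-card-shift : ∀ n m i → i ≤ m + n → sumSubsets n (λ A → ⟦ m + card A ≡ᵇ i ⟧) ≡ n C (m + n ∸ i)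
sumSubsets-card-shift n m i i≤m+n =
  trans (sumSubsets-cong n (λ A → cong ⟦_⟧ (≡ᵇ-shift m (card A) i)))
        (trans (sumSubsets-∧ n (m ≤ᵇ i) _) binomial)
  where
  binomial : (if m ≤ᵇ i then sumSubsets n (λ A → ⟦ card A ≡ᵇ i ∸ m ⟧) else 0) ≡ n C (m + n ∸ i)
  binomial with m ≤ᵇ i | ≤ᵇ-reflects-≤ m i
  ... | true  | ofʸ m≤i = begin
    sumSubsets n (λ A → ⟦ card A ≡ᵇ i ∸ m ⟧) ≡⟨ sumSubsets-card n (i ∸ m) ⟩
    n C (i ∸ m)                              ≡⟨ nCk≡nC[n∸k] i∸m≤n ⟩
    n C (n ∸ (i ∸ m))                        ≡⟨ cong (n C_) (≡.sym ([m+n]∸[m+o]≡n∸o m n (i ∸ m))) ⟩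
    n C (m + n ∸ (m + (i ∸ m)))              ≡⟨ cong (λ o → n C (m + n ∸ o)) (m+[n∸m]≡n m≤i) ⟩
    n C (m + n ∸ i)                          ∎
    where
    open ≡.≡-Reasoning
    i∸m≤n : i ∸ m ≤ n
    i∸m≤n = ≤-trans (∸-monoˡ-≤ m i≤m+n) (≤-reflexive (m+n∸m≡n m n))
  ... | false | ofⁿ m≰i = ≡.sym (k>n⇒nCk≡0 (begin-strict
    n               <⟨ +-monoˡ-< n (m<n⇒0<n∸m i<m) ⟩
    (m ∸ i) + n     ≡⟨ +-∸-comm n (<⇒≤ i<m) ⟨
    m + n ∸ i       ∎))
    where
    open ≤-Reasoning
    i<m : i < m
    i<m = ≰⇒> m≰i

inclusion-exclusion : ∀ a b x y z → (T a → T b → ¬ T y × ¬ T z) →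
  ⟦ if b then x else if a then y else z ⟧ + (if b then ⟦ z ⟧ else 0) + (if a then ⟦ z ⟧ else 0)
    ≡ (if b then ⟦ x ⟧ else 0) + (if a then ⟦ y ⟧ else 0) + ⟦ z ⟧
inclusion-exclusion false false x y z _ = trans (+-identityʳ _) (+-identityʳ _)
inclusion-exclusion true  false x y z _ = cong (_+ ⟦ z ⟧) (+-identityʳ _)
inclusion-exclusion false true  x y z _ = trans (+-identityʳ _) (cong (_+ ⟦ z ⟧) (≡.sym (+-identityʳ _)))
inclusion-exclusion true  true  x true  z     excl = ⊥-elim (proj₁ (excl tt tt) tt)
inclusion-exclusion true  true  x false true  excl = ⊥-elim (proj₂ (excl tt tt) tt)
inclusion-exclusion true  true  x false false _    = refl

-- Coefficients of the f-polynomials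

faceCount : ∀ {n} → ℕ → Graph n → ℕ → ℕ
faceCount {n} k G i = sumSubsets n (λ σ → ⟦ (card σ ≡ᵇ i) ∧ isCutFaceᵇ k G σ ⟧)

fPolyCut≡faceCount : ∀ {n} k (G : Graph n) i → fPolyCut k G i ≡ + faceCount k G i
fPolyCut≡faceCount {n} k G i = cong +_ (length-filterᵇ-allSubsets n _)

shiftedFaceCount : ∀ {n} → ℕ → ℕ → Graph n → ℕ → ℕ
shiftedFaceCount m k G i = if m ≤ᵇ i then faceCount k G (i ∸ m) else 0

xpow-fPolyCut : ∀ {n} m k (G : Graph n) i → (xpow m · fPolyCut k G) i ≡ + shiftedFaceCount m k G i
xpow-fPolyCut m k G i = guarded (m ≤ᵇ i)
  where
  guarded : ∀ b → (if b then fPolyCut k G (i ∸ m) else + 0) ≡ + (if b then faceCount k G (i ∸ m) else 0)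
  guarded true  = fPolyCut≡faceCount k G (i ∸ m)
  guarded false = refl

pos-+₃ : ∀ a b c → + (a + b + c) ≡ + a ℤ.+ + b ℤ.+ + c
pos-+₃ a b c = trans (ℤ.pos-+ (a + b) c) (cong (ℤ._+ + c) (ℤ.pos-+ a b))

isolate-ℤ : ∀ b t x y w u v →
  t + (if b then u else 0) + (if b then v else 0) ≡ x + y + (if b then w else 0) →
  + t ≡ (+ x ℤ.+ + y) ℤ.+ (if b then + w - + u - + v else + 0)
isolate-ℤ false t x y w u v eq = begin
  + t                   ≡⟨ cong +_ t≡x+y ⟩
  + (x + y)             ≡⟨ ℤ.pos-+ x y ⟩
  + x ℤ.+ + y           ≡⟨ ℤ.+-identityʳ _ ⟨
  (+ x ℤ.+ + y) ℤ.+ + 0 ∎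
  where
  open ≡.≡-Reasoning
  t≡x+y : t ≡ x + y
  t≡x+y = trans (≡.sym (trans (+-identityʳ (t + 0)) (+-identityʳ t))) (trans eq (+-identityʳ (x + y)))
isolate-ℤ true t x y w u v eq = begin
  + t                                       ≡⟨ cancel (+ t) (+ u) (+ v) ⟩
  + t ℤ.+ + u ℤ.+ + v - + u - + v           ≡⟨ cong (λ s → s - + u - + v) (≡.sym (pos-+₃ t u v)) ⟩
  + (t + u + v) - + u - + v                 ≡⟨ cong (λ s → + s - + u - + v) eq ⟩
  + (x + y + w) - + u - + v                 ≡⟨ cong (λ s → s - + u - + v) (pos-+₃ x y w) ⟩
  + x ℤ.+ + y ℤ.+ + w - + u - + v           ≡⟨ regroup (+ x) (+ y) (+ w) (+ u) (+ v) ⟩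
  (+ x ℤ.+ + y) ℤ.+ (+ w - + u - + v)       ∎
  where
  open ≡.≡-Reasoning
  open +-*-Solver
  cancel : ∀ a b c → a ≡ a ℤ.+ b ℤ.+ c - b - c
  cancel = solve 3 (λ a b c → a := a :+ b :+ c :- b :- c) refl
  regroup : ∀ a b c d e → a ℤ.+ b ℤ.+ c - d - e ≡ (a ℤ.+ b) ℤ.+ (c - d - e)
  regroup = solve 5 (λ a b c d e → a :+ b :+ c :- d :- e := (a :+ b) :+ (c :- d :- e)) refl

module Coefficient (k : ℕ) {n₁ n₂} (G₁ : Graph n₁) (G₂ : Graph n₂) (i : ℕ) where

  inRange : Bool
  inRange = i + k ≤ᵇ n₁ + n₂

  sized : Subset n₁ → Subset n₂ → Bool
  sized A B = card A + card B ≡ᵇ i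

  Σ₂ : (Subset n₁ → Subset n₂ → ℕ) → ℕ
  Σ₂ f = sumSubsets n₁ (λ A → sumSubsets n₂ (f A))

  Σ₂-cong : ∀ {f g : Subset n₁ → Subset n₂ → ℕ} → (∀ A B → f A B ≡ g A B) → Σ₂ f ≡ Σ₂ g
  Σ₂-cong f≗g = sumSubsets-cong n₁ (λ A → sumSubsets-cong n₂ (f≗g A))

  Σ₂-+ : ∀ (f g : Subset n₁ → Subset n₂ → ℕ) → Σ₂ (λ A B → f A B + g A B) ≡ Σ₂ f + Σ₂ g
  Σ₂-+ f g = trans (sumSubsets-cong n₁ (λ A → sumSubsets-+ n₂ (f A) (g A))) (sumSubsets-+ n₁ _ _)

  Σ₂-+₃ : ∀ (f g h : Subset n₁ → Subset n₂ → ℕ) →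
          Σ₂ (λ A B → f A B + g A B + h A B) ≡ Σ₂ f + Σ₂ g + Σ₂ h
  Σ₂-+₃ f g h = trans (Σ₂-+ (λ A B → f A B + g A B) h) (cong (_+ Σ₂ h) (Σ₂-+ f g))

  Σ₂-fullʳ : ∀ (f : Subset n₁ → Subset n₂ → ℕ) →
             Σ₂ (λ A B → if card B ≡ᵇ n₂ then f A B else 0) ≡ sumSubsets n₁ (λ A → f A ⊤)
  Σ₂-fullʳ f = sumSubsets-cong n₁ (λ A → sumSubsets-full n₂ (f A))

  Σ₂-fullˡ : ∀ (f : Subset n₁ → Subset n₂ → ℕ) →
             Σ₂ (λ A B → if card A ≡ᵇ n₁ then f A B else 0) ≡ sumSubsets n₂ (f ⊤)
  Σ₂-fullˡ f = trans (sumSubsets-cong n₁ (λ A → sumSubsets-if n₂ (card A ≡ᵇ n₁) (f A)))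
                     (sumSubsets-full n₁ (λ A → sumSubsets n₂ (f A)))

  Σ₂-++ : ∀ (h : ℕ → Subset (n₁ + n₂) → ℕ) →
          Σ₂ (λ A B → h (card A + card B) (A ++ᵥ B)) ≡ sumSubsets (n₁ + n₂) (λ σ → h (card σ) σ)
  Σ₂-++ h = ≡.sym (trans (sumSubsets-++ n₁ n₂ _) (Σ₂-cong (λ A B → cong (λ m → h m (A ++ᵥ B)) (card-++ A B))))

  card-+⊤ : ∀ (A : Subset n₁) → card A + card (⊤ {n₂}) ≡ n₂ + card A
  card-+⊤ A = trans (cong (_+_ (card A)) (card-⊤ n₂)) (+-comm (card A) n₂)

  sumSubsets-inRange-card : ∀ n m → m + n ≡ n₁ + n₂ →
    sumSubsets n (λ X → ⟦ inRange ∧ (m + card X ≡ᵇ i) ⟧) ≡ (if inRange then n C (n₁ + n₂ ∸ i) else 0)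
  sumSubsets-inRange-card n m m+n≡ with inRange | ≤ᵇ-reflects-≤ (i + k) (n₁ + n₂)
  ... | false | _          = sumSubsets-zero n
  ... | true  | ofʸ i+k≤n =
    subst (λ N → sumSubsets n (λ X → ⟦ m + card X ≡ᵇ i ⟧) ≡ n C (N ∸ i)) m+n≡
          (sumSubsets-card-shift n m i (subst (i ≤_) (≡.sym m+n≡) (≤-trans (m≤m+n i k) i+k≤n)))

  Σ₂-face-⊕ : Σ₂ (λ A B → ⟦ sized A B ∧ isCutFaceᵇ k (G₁ ⊕ G₂) (A ++ᵥ B) ⟧) ≡ faceCount k (G₁ ⊕ G₂) i
  Σ₂-face-⊕ = Σ₂-++ (λ m σ → ⟦ (m ≡ᵇ i) ∧ isCutFaceᵇ k (G₁ ⊕ G₂) σ ⟧)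

  Σ₂-fullʳ-face : Σ₂ (λ A B → if card B ≡ᵇ n₂ then ⟦ sized A B ∧ isCutFaceᵇ k G₁ A ⟧ else 0) ≡
                  shiftedFaceCount n₂ k G₁ i
  Σ₂-fullʳ-face = trans (Σ₂-fullʳ _)
    (trans (sumSubsets-cong n₁ (λ A → cong (λ m → ⟦ (m ≡ᵇ i) ∧ isCutFaceᵇ k G₁ A ⟧) (card-+⊤ A)))
           (sumSubsets-shift n₁ n₂ i _))

  Σ₂-fullˡ-face : Σ₂ (λ A B → if card A ≡ᵇ n₁ then ⟦ sized A B ∧ isCutFaceᵇ k G₂ B ⟧ else 0) ≡
                  shiftedFaceCount n₁ k G₂ i
  Σ₂-fullˡ-face = trans (Σ₂-fullˡ _)
    (trans (sumSubsets-cong n₂ (λ B → cong (λ m → ⟦ (m + card B ≡ᵇ i) ∧ isCutFaceᵇ k G₂ B ⟧) (card-⊤ n₁)))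
           (sumSubsets-shift n₂ n₁ i _))

  Σ₂-fullʳ-inRange : Σ₂ (λ A B → if card B ≡ᵇ n₂ then ⟦ inRange ∧ sized A B ⟧ else 0) ≡
                     (if inRange then n₁ C (n₁ + n₂ ∸ i) else 0)
  Σ₂-fullʳ-inRange = trans (Σ₂-fullʳ _)
    (trans (sumSubsets-cong n₁ (λ A → cong (λ m → ⟦ inRange ∧ (m ≡ᵇ i) ⟧) (card-+⊤ A)))
           (sumSubsets-inRange-card n₁ n₂ (+-comm n₂ n₁)))

  Σ₂-fullˡ-inRange : Σ₂ (λ A B → if card A ≡ᵇ n₁ then ⟦ inRange ∧ sized A B ⟧ else 0) ≡
                     (if inRange then n₂ C (n₁ + n₂ ∸ i) else 0)
  Σ₂-fullˡ-inRange = trans (Σ₂-fullˡ _)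
    (trans (sumSubsets-cong n₂ (λ B → cong (λ m → ⟦ inRange ∧ (m + card B ≡ᵇ i) ⟧) (card-⊤ n₁)))
           (sumSubsets-inRange-card n₂ n₁ refl))

  Σ₂-inRange : Σ₂ (λ A B → ⟦ inRange ∧ sized A B ⟧) ≡ (if inRange then (n₁ + n₂) C (n₁ + n₂ ∸ i) else 0)
  Σ₂-inRange = trans (Σ₂-++ (λ m _ → ⟦ inRange ∧ (m ≡ᵇ i) ⟧)) (sumSubsets-inRange-card (n₁ + n₂) 0 refl)

  module _ (2≤k : 2 ≤ k) where

    isCutFaceᵇ-⊕-sized : ∀ A B →
      sized A B ∧ isCutFaceᵇ k (G₁ ⊕ G₂) (A ++ᵥ B) ≡
        (if card B ≡ᵇ n₂ then sized A B ∧ isCutFaceᵇ k G₁ A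
         else if card A ≡ᵇ n₁ then sized A B ∧ isCutFaceᵇ k G₂ B
         else inRange ∧ sized A B)
    isCutFaceᵇ-⊕-sized A B rewrite isCutFaceᵇ-⊕ k G₁ G₂ A B 2≤k with card B ≡ᵇ n₂ | card A ≡ᵇ n₁
    ... | true  | _     = refl
    ... | false | true  = refl
    ... | false | false with sized A B | ≡ᵇ-reflects-≡ (card A + card B) i
    ...   | false | _         = ≡.sym (∧-zeroʳ inRange)
    ...   | true  | ofʸ sized≡ = trans (+-≤ᵇ {a = i} k total) (≡.sym (∧-identityʳ inRange))
      where
      total : i + (card (∁ A) + card (∁ B)) ≡ n₁ + n₂
      total = trans (cong (_+ _) (≡.sym sized≡))
                    (trans (+-interchange (card A) (card B) _ _) (cong₂ _+_ (card+card-∁ A) (card+card-∁ B)))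

    0<k : 0 < k
    0<k = ≤-trans (s≤s z≤n) 2≤k

    both-full-excluded : ∀ A B → T (card A ≡ᵇ n₁) → T (card B ≡ᵇ n₂) →
                         ¬ T (sized A B ∧ isCutFaceᵇ k G₂ B) × ¬ T (inRange ∧ sized A B)
    both-full-excluded A B A-full B-full = ¬face₂ , ¬inRange
      where
      ¬face₂ : ¬ T (sized A B ∧ isCutFaceᵇ k G₂ B)
      ¬face₂ h = ¬isCutFaceᵇ-full 0<k (≡ᵇ⇒≡ (card B) n₂ B-full) (proj₂ (to T-∧ h))
      ¬inRange : ¬ T (inRange ∧ sized A B)
      ¬inRange h with to T-∧ h
      ... | i+k≤n , sized≡ = ≤⇒≯ (subst (i + k ≤_) (≡.sym i≡n) (≤ᵇ⇒≤ (i + k) _ i+k≤n)) (m<m+n i 0<k)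
        where
        i≡n : i ≡ n₁ + n₂
        i≡n = trans (≡.sym (≡ᵇ⇒≡ _ i sized≡)) (cong₂ _+_ (≡ᵇ⇒≡ (card A) n₁ A-full) (≡ᵇ⇒≡ (card B) n₂ B-full))

    count-⊕-pointwise : ∀ A B →
      ⟦ sized A B ∧ isCutFaceᵇ k (G₁ ⊕ G₂) (A ++ᵥ B) ⟧
        + (if card B ≡ᵇ n₂ then ⟦ inRange ∧ sized A B ⟧ else 0)
        + (if card A ≡ᵇ n₁ then ⟦ inRange ∧ sized A B ⟧ else 0)
      ≡ (if card B ≡ᵇ n₂ then ⟦ sized A B ∧ isCutFaceᵇ k G₁ A ⟧ else 0)
        + (if card A ≡ᵇ n₁ then ⟦ sized A B ∧ isCutFaceᵇ k G₂ B ⟧ else 0)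
        + ⟦ inRange ∧ sized A B ⟧
    count-⊕-pointwise A B =
      trans (cong₂ _+_ (cong₂ _+_ (cong ⟦_⟧ (isCutFaceᵇ-⊕-sized A B)) refl) refl)
            (inclusion-exclusion (card A ≡ᵇ n₁) (card B ≡ᵇ n₂) _ _ _ (both-full-excluded A B))

    -- The sets with A = V(G₁) or B = V(G₂) are added on the left instead of
    -- being subtracted on the right, which keeps the identity in ℕ.
    count-⊕ :
      faceCount k (G₁ ⊕ G₂) i
        + (if inRange then n₁ C (n₁ + n₂ ∸ i) else 0)
        + (if inRange then n₂ C (n₁ + n₂ ∸ i) else 0)
      ≡ shiftedFaceCount n₂ k G₁ i
        + shiftedFaceCount n₁ k G₂ i
        + (if inRange then (n₁ + n₂) C (n₁ + n₂ ∸ i) else 0)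
    count-⊕ = begin
      faceCount k (G₁ ⊕ G₂) i + _ + _
        ≡⟨ cong₂ _+_ (cong₂ _+_ Σ₂-face-⊕ Σ₂-fullʳ-inRange) Σ₂-fullˡ-inRange ⟨
      Σ₂ (λ A B → ⟦ sized A B ∧ isCutFaceᵇ k (G₁ ⊕ G₂) (A ++ᵥ B) ⟧)
        + Σ₂ (λ A B → if card B ≡ᵇ n₂ then ⟦ inRange ∧ sized A B ⟧ else 0)
        + Σ₂ (λ A B → if card A ≡ᵇ n₁ then ⟦ inRange ∧ sized A B ⟧ else 0)
        ≡⟨ Σ₂-+₃ _ _ _ ⟨
      Σ₂ _
        ≡⟨ Σ₂-cong count-⊕-pointwise ⟩
      Σ₂ _
        ≡⟨ Σ₂-+₃ _ _ _ ⟩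
      Σ₂ (λ A B → if card B ≡ᵇ n₂ then ⟦ sized A B ∧ isCutFaceᵇ k G₁ A ⟧ else 0)
        + Σ₂ (λ A B → if card A ≡ᵇ n₁ then ⟦ sized A B ∧ isCutFaceᵇ k G₂ B ⟧ else 0)
        + Σ₂ (λ A B → ⟦ inRange ∧ sized A B ⟧)
        ≡⟨ cong₂ _+_ (cong₂ _+_ Σ₂-fullʳ-face Σ₂-fullˡ-face) Σ₂-inRange ⟩
      _ ∎
      where open ≡.≡-Reasoning

    coefficient-⊕ :
      + faceCount k (G₁ ⊕ G₂) i ≡
        (+ shiftedFaceCount n₂ k G₁ i ℤ.+ + shiftedFaceCount n₁ k G₂ i)
          ℤ.+ (if inRange then + ((n₁ + n₂) C (n₁ + n₂ ∸ i)) - + (n₁ C (n₁ + n₂ ∸ i)) - + (n₂ C (n₁ + n₂ ∸ i))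
               else + 0)
    coefficient-⊕ =
      isolate-ℤ inRange _ (shiftedFaceCount n₂ k G₁ i) (shiftedFaceCount n₁ k G₂ i) _ _ _ count-⊕

map-+-applyUpTo : ∀ a (h : ℕ → ℕ) d → map (_+_ a) (applyUpTo (suc ∘ h) d) ≡ map (_+_ (suc a)) (applyUpTo h d)
map-+-applyUpTo a h zero    = refl
map-+-applyUpTo a h (suc d) = cong₂ _∷_ (+-suc a (h 0)) (map-+-applyUpTo a (h ∘ suc) d)

sumRange-step : ∀ {a b} f i → a ≤ b → sumRange a b f i ≡ f a i ℤ.+ sumRange (suc a) b f i
sumRange-step {a} {b} f i a≤b
  rewrite +-∸-assoc 1 a≤b | +-identityʳ a | map-+-applyUpTo a (λ j → j) (b ∸ a) = refl

sumRange-empty : ∀ {a b} f i → b < a → sumRange a b f i ≡ + 0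
sumRange-empty f i b<a rewrite m≤n⇒m∸n≡0 b<a = refl

sumRange-mono-∸ : ∀ n (g : ℕ → ℤ.ℤ) a i →
  sumRange a n (λ j → mono (g j) (n ∸ j)) i ≡ (if i + a ≤ᵇ n then g (n ∸ i) else + 0)
sumRange-mono-∸ n g a i = by-length (suc n ∸ a) a refl
  where
  F : ℕ → Poly
  F j = mono (g j) (n ∸ j)

  -- The term j = a is the one that contributes exactly when i + a ≡ n.
  head+tail : ∀ {a} → a ≤ n →
    F a i ℤ.+ (if i + suc a ≤ᵇ n then g (n ∸ i) else + 0) ≡ (if i + a ≤ᵇ n then g (n ∸ i) else + 0)
  head+tail {a} a≤n with <-cmp (i + a) n | subst (i + a <_) (≡.sym (+-suc i a)) (n<1+n (i + a))
  ... | tri< i+a<n _ _ | _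
    rewrite ≡ᵇ-false {i} {n ∸ a} (λ i≡ → <-irrefl (trans (cong (_+ a) i≡) (m∸n+n≡m a≤n)) i+a<n)
          | ≤ᵇ-true (≤-trans (≤-reflexive (+-suc i a)) i+a<n) | ≤ᵇ-true (<⇒≤ i+a<n) = ℤ.+-identityˡ _
  ... | tri≈ _ i+a≡n _ | i+a<i+1+a
    rewrite ≡ᵇ-true {i} {n ∸ a} (trans (≡.sym (m+n∸n≡m i a)) (cong (_∸ a) i+a≡n))
          | ≤ᵇ-false {i + suc a} {n} (subst (_< i + suc a) i+a≡n i+a<i+1+a)
          | ≤ᵇ-true (≤-reflexive i+a≡n) =
      trans (ℤ.+-identityʳ _) (cong g (trans (≡.sym (m+n∸m≡n i a)) (cong (_∸ i) i+a≡n)))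
  ... | tri> _ _ n<i+a | i+a<i+1+a
    rewrite ≡ᵇ-false {i} {n ∸ a} (λ i≡ → <-irrefl (≡.sym (trans (cong (_+ a) i≡) (m∸n+n≡m a≤n))) n<i+a)
          | ≤ᵇ-false {i + suc a} {n} (<-trans n<i+a i+a<i+1+a)
          | ≤ᵇ-false n<i+a = refl

  by-length : ∀ d a → suc n ∸ a ≡ d →
    sumRange a n F i ≡ (if i + a ≤ᵇ n then g (n ∸ i) else + 0)
  by-length zero a n<a rewrite ≤ᵇ-false {i + a} {n} (≤-trans (m∸n≡0⇒m≤n n<a) (m≤n+m a i)) =
    sumRange-empty {a} {n} F i (m∸n≡0⇒m≤n n<a)
  by-length (suc d) a len with a ≤? n
  ... | no  a≰n = ⊥-elim (0≢1+n (trans (≡.sym (m≤n⇒m∸n≡0 (≰⇒> a≰n))) len))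
  ... | yes a≤n =
    trans (sumRange-step F i a≤n) (trans (cong (ℤ._+_ (F a i)) (by-length d (suc a) len′)) (head+tail a≤n))
    where
    len′ : n ∸ a ≡ d
    len′ = suc-injective (trans (≡.sym (+-∸-assoc 1 a≤n)) len)

theorem3p8 : (k n₁ n₂ : ℕ) → 2 ≤ k → 1 ≤ n₁ → 1 ≤ n₂ →
    (G₁ : Graph n₁) (G₂ : Graph n₂) → (i : ℕ) →
    fPolyCut k (G₁ ⊕ G₂) i ≡
      ((xpow n₂ · fPolyCut k G₁) +ₚ (xpow n₁ · fPolyCut k G₂)
        +ₚ sumRange k (n₁ + n₂)
             (λ j → mono (+ ((n₁ + n₂) C j) - + (n₁ C j) - + (n₂ C j)) ((n₁ + n₂) ∸ j))) i
-- The identity holds for empty G₁ or G₂ as well.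
theorem3p8 k n₁ n₂ 2≤k _ _ G₁ G₂ i = begin
  fPolyCut k (G₁ ⊕ G₂) i
    ≡⟨ fPolyCut≡faceCount k (G₁ ⊕ G₂) i ⟩
  + faceCount k (G₁ ⊕ G₂) i
    ≡⟨ Coefficient.coefficient-⊕ k G₁ G₂ i 2≤k ⟩
  _
    ≡⟨ cong₂ ℤ._+_ (cong₂ ℤ._+_ (xpow-fPolyCut n₂ k G₁ i) (xpow-fPolyCut n₁ k G₂ i))
                   (sumRange-mono-∸ (n₁ + n₂) (λ j → + ((n₁ + n₂) C j) - + (n₁ C j) - + (n₂ C j)) k i) ⟨
  _ ∎
  where open ≡.≡-Reasoning
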